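{- For every integer $k\ge16$, the predicate $\operatorname{LIN}_{k,6,\{0,1\}}$ has no quadratic representation over any Abelian group $G$.
   Context: $\operatorname{LIN}_{k,6,\{0,1\}}=\{x\in\{0,1\}^k:\operatorname{Ham}(x)\equiv0\text{ or }1\pmod 6\}$, where $\operatorname{Ham}(x)=\sum_ix_i$. For $h\in G$ let $h\cdot0=0$ and $h\cdot1=h$. A quadratic representation of a set $S\subseteq\{0,1\}^k$ over an Abelian group $G$ is a choice of $g_0,g_i,g_{ij}\in G$ ($i\in[k]$, $1\le i<j\le k$) such that the map $g(x)=g_0+\sum_{i=1}^kg_i\cdot x_i+\sum_{1\le i<j\le k}g_{ij}\cdot(x_ix_j)$ satisfies, for all $x\in\{0,1\}^k$, $g(x)=0$ if and only if $x\in S$. -}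

module Defs where

open import Level using (Level)
open import Data.Nat using (ℕ; zero; suc; _%_)
open import Data.Fin using (Fin; zero; suc; _<_)
open import Data.Fin.Properties using (_<?_)
open import Data.Bool using (Bool; true; false)
import Data.Bool
import Data.Product
open import Data.Sum using (_⊎_)
open import Relation.Binary.PropositionalEquality using (_≡_)
open import Relation.Nullary using (¬_; yes; no)
open import Algebra.Bundles using (AbelianGroup)

Ham : ∀ {k} → (Fin k → Bool) → ℕ
Ham {zero}  x = 0
Ham {suc k} x with x zero
... | true  = suc (Ham (λ i → x (suc i)))
... | false = Ham (λ i → x (suc i))

InLIN6 : ∀ {k} → (Fin k → Bool) → Set
InLIN6 x = (Ham x % 6 ≡ 0) ⊎ (Ham x % 6 ≡ 1)

module _ {c ℓ : Level} (G : AbelianGroup c ℓ) where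
  open AbelianGroup G renaming (Carrier to A)

  scale : A → Bool → A
  scale h true  = h
  scale h false = ε

  sumG : ∀ {k} → (Fin k → A) → A
  sumG {zero}  f = ε
  sumG {suc k} f = f zero ∙ sumG (λ i → f (suc i))

  -- g(x) = g₀ + Σ_i gᵢ·xᵢ + Σ_{i<j} g_{ij}·(xᵢ xⱼ)
  -- (entries g_{ij} with ¬ i < j are never used)
  quadEval : ∀ {k} → A → (Fin k → A) → (Fin k → Fin k → A) → (Fin k → Bool) → A
  quadEval g₀ g₁ g₂ x =
    g₀ ∙ (sumG (λ i → scale (g₁ i) (x i))
          ∙ sumG (λ i → sumG (λ j → pairTerm i j)))
    where
      pairTerm : _ → _ → A
      pairTerm i j with i <? j
      ... | yes _ = scale (g₂ i j) (x i Data.Bool.∧ x j)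
      ... | no  _ = ε

  IsQuadRep : ∀ {k} → ((Fin k → Bool) → Set) → A → (Fin k → A) → (Fin k → Fin k → A) → Set ℓ
  IsQuadRep S g₀ g₁ g₂ =
    ∀ x → (quadEval g₀ g₁ g₂ x ≈ ε → S x) Data.Product.× (S x → quadEval g₀ g₁ g₂ x ≈ ε)

{-# OPTIONS --safe #-}
module Submission where

-- A quadratic representation g(x) = g₀ + Σᵢ gᵢ xᵢ + Σ_{i<j} gᵢⱼ xᵢxⱼ is a ℤ-linear function of the
-- moment vector (1, xᵢ, xᵢxⱼ) of x. Hence Σₜ g(pₜ) = Σₜ g(qₜ) for any two families of points with
-- the same number of points and the same number of ones in every coordinate and every pair of
-- coordinates. In {0,1}⁸ there are families p and x ∷ q of this kind with every point of p and q
-- in LIN while x = 11110000 has weight 4: g vanishes on p and q, hence on x, so x ∈ LIN, which is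
-- absurd. Fixing all but eight coordinates to 0 turns a representation of LIN in dimension k into
-- one in dimension 8, so the argument works for every k ≥ 8.

open import Defs
open import Level using (Level; _⊔_)
open import Data.Nat using (ℕ; _≤_; zero; suc; _%_; _≟_; _≡ᵇ_; _≤′_; ≤′-refl; ≤′-step)
open import Data.Nat.Properties using (≤-trans; m≤m+n; ≤⇒≤′)
open import Data.Fin using (Fin; zero; suc)
open import Data.Fin.Properties using (_<?_; all?)
open import Data.Bool using (Bool; true; false; _∧_; if_then_else_)
open import Data.Bool.Properties using (∧-idem)
open import Data.Vec.Functional using (Vector; []; _∷_; head; tail)
open import Data.Product using (∃; ∃₂; _,_; proj₁; proj₂)
open import Function using (id)
open import Relation.Nullary using (¬_; Dec; yes; no)
open import Relation.Nullary.Decidable using (does; from-yes; from-no; _⊎-dec_)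
open import Relation.Binary.PropositionalEquality using (_≡_; refl; sym; cong; module ≡-Reasoning)
open import Algebra.Bundles using (AbelianGroup)

count : ∀ {n} → Vector Bool n → ℕ
count {zero}  b = 0
count {suc n} b = (if head b then suc else id) (count (tail b))

count-cong : ∀ {n} {b b′ : Vector Bool n} → (∀ t → b t ≡ b′ t) → count b ≡ count b′
count-cong {zero}  _ = refl
count-cong {suc n} {b} {b′} b≡b′ rewrite b≡b′ zero =
  cong (if b′ zero then suc else id) (count-cong (λ t → b≡b′ (suc t)))

count-∧ˡ : ∀ {n} (c : Bool) {b b′ : Vector Bool n} →
           count b ≡ count b′ → count (λ t → c ∧ b t) ≡ count (λ t → c ∧ b′ t)
count-∧ˡ true  eq = eq
count-∧ˡ false _  = refl

SameMoments : ∀ {n k} → (p q : Vector (Fin k → Bool) n) → Set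
SameMoments p q = ∀ i j → count (λ t → p t i ∧ p t j) ≡ count (λ t → q t i ∧ q t j)

sameMoments? : ∀ {n k} (p q : Vector (Fin k → Bool) n) → Dec (SameMoments p q)
sameMoments? p q = all? λ i → all? λ j → count (λ t → p t i ∧ p t j) ≟ count (λ t → q t i ∧ q t j)

SameMoments⇒same-first-moments : ∀ {n k} {p q : Vector (Fin k → Bool) n} →
                                 SameMoments p q → ∀ i → count (λ t → p t i) ≡ count (λ t → q t i)
SameMoments⇒same-first-moments {p = p} {q} same i = begin
  count (λ t → p t i)          ≡⟨ count-cong (λ t → sym (∧-idem (p t i))) ⟩
  count (λ t → p t i ∧ p t i)  ≡⟨ same i i ⟩
  count (λ t → q t i ∧ q t i)  ≡⟨ count-cong (λ t → ∧-idem (q t i)) ⟩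
  count (λ t → q t i)          ∎
  where open ≡-Reasoning

inLIN6? : ∀ {k} (x : Fin k → Bool) → Dec (InLIN6 x)
inLIN6? x = (Ham x % 6 ≟ 0) ⊎-dec (Ham x % 6 ≟ 1)

module _ {c ℓ : Level} (G : AbelianGroup c ℓ) where
  open AbelianGroup G renaming (Carrier to A; refl to ≈-refl; sym to ≈-sym; trans to ≈-trans)
  open import Algebra.Properties.CommutativeMonoid.Sum commutativeMonoid
    using (sum; sum-syntax; ∑-comm; ∑-distrib-+; sum-cong-≋; sum-replicate; sum-replicate-zero)
  open import Algebra.Properties.Monoid.Mult monoid using (_×_; ×-congˡ)
  open import Relation.Binary.Reasoning.Setoid setoid

  sumG≈sum : ∀ {k} {f h : Fin k → A} → (∀ i → f i ≈ h i) → sumG G f ≈ sum h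
  sumG≈sum {zero}  _   = ≈-refl
  sumG≈sum {suc k} f≈h = ∙-cong (f≈h zero) (sumG≈sum (λ i → f≈h (suc i)))

  sum-zero : ∀ {n} {f : Vector A n} → (∀ t → f t ≈ ε) → sum f ≈ ε
  sum-zero {n} f≈ε = ≈-trans (sum-cong-≋ {n} f≈ε) (sum-replicate-zero n)

  -- does (i <? j) reduces to toℕ i <ᵇ toℕ j and so computes on zero and suc; ⌊ i <? j ⌋ does not.
  pairTerm : ∀ {k} → (Fin k → Fin k → A) → (Fin k → Bool) → Fin k → Fin k → A
  pairTerm g₂ x i j = scale G (g₂ i j) (does (i <? j) ∧ (x i ∧ x j))

  quadEval′ : ∀ {k} → A → (Fin k → A) → (Fin k → Fin k → A) → (Fin k → Bool) → A
  quadEval′ {k} g₀ g₁ g₂ x =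
    g₀ ∙ (∑[ i < k ] scale G (g₁ i) (x i) ∙ ∑[ i < k ] ∑[ j < k ] pairTerm g₂ x i j)

  -- The pair term of quadEval is local to its where block; unifying quadEval with its own unfolding
  -- is the only way to refer to it.
  private
    localPairTerm : ∀ {k} {g₀ : A} {g₁ : Fin k → A} {g₂ : Fin k → Fin k → A} {x : Fin k → Bool}
                    {T : Fin k → Fin k → A} →
                    quadEval G g₀ g₁ g₂ x
                      ≡ g₀ ∙ (sumG G (λ i → scale G (g₁ i) (x i)) ∙ sumG G (λ i → sumG G (T i))) →
                    Fin k → Fin k → A
    localPairTerm {T = T} _ = T

    localPairTerm≈pairTerm : ∀ {k} g₀ g₁ g₂ (x : Fin k → Bool) i j →
                             localPairTerm {g₀ = g₀} {g₁} {g₂} {x} refl i j ≈ pairTerm g₂ x i j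
    localPairTerm≈pairTerm g₀ g₁ g₂ x i j with i <? j in i<?j
    ... | yes _ = reflexive (cong (λ d → scale G (g₂ i j) (does d ∧ (x i ∧ x j))) (sym i<?j))
    ... | no  _ = reflexive (cong (λ d → scale G (g₂ i j) (does d ∧ (x i ∧ x j))) (sym i<?j))

  quadEval≈quadEval′ : ∀ {k} g₀ g₁ g₂ (x : Fin k → Bool) → quadEval G g₀ g₁ g₂ x ≈ quadEval′ g₀ g₁ g₂ x
  quadEval≈quadEval′ {k} g₀ g₁ g₂ x =
    ∙-congˡ (∙-cong (sumG≈sum {k} (λ _ → ≈-refl))
                    (sumG≈sum {k} (λ i → sumG≈sum {k} (localPairTerm≈pairTerm g₀ g₁ g₂ x i))))

  quadEval′-face : ∀ {k} g₀ (g₁ : Fin (suc k) → A) g₂ (x : Fin k → Bool) →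
                   quadEval′ g₀ g₁ g₂ (false ∷ x) ≈ quadEval′ g₀ (tail g₁) (λ i j → g₂ (suc i) (suc j)) x
  quadEval′-face {k} g₀ g₁ g₂ x =
    ∙-congˡ (∙-cong (identityˡ _) (≈-trans (∙-cong row₀ rows) (identityˡ _)))
    where
    row₀ : ε ∙ ∑[ j < k ] ε ≈ ε
    row₀ = ≈-trans (identityˡ _) (sum-replicate-zero k)
    rows : ∑[ i < k ] (ε ∙ ∑[ j < k ] pairTerm g₂ (false ∷ x) (suc i) (suc j))
         ≈ ∑[ i < k ] ∑[ j < k ] pairTerm g₂ (false ∷ x) (suc i) (suc j)
    rows = sum-cong-≋ {k} (λ _ → identityˡ _)

  quadEval-face : ∀ {k} g₀ (g₁ : Fin (suc k) → A) g₂ (x : Fin k → Bool) →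
                  quadEval G g₀ g₁ g₂ (false ∷ x) ≈ quadEval G g₀ (tail g₁) (λ i j → g₂ (suc i) (suc j)) x
  quadEval-face {k} g₀ g₁ g₂ x = begin
    quadEval G g₀ g₁ g₂ (false ∷ x)  ≈⟨ quadEval≈quadEval′ g₀ g₁ g₂ (false ∷ x) ⟩
    quadEval′ g₀ g₁ g₂ (false ∷ x)   ≈⟨ quadEval′-face g₀ g₁ g₂ x ⟩
    quadEval′ g₀ g₁′ g₂′ x           ≈⟨ quadEval≈quadEval′ g₀ g₁′ g₂′ x ⟨
    quadEval G g₀ g₁′ g₂′ x          ∎
    where
    g₁′ : Fin k → A
    g₁′ = tail g₁
    g₂′ : Fin k → Fin k → A
    g₂′ i j = g₂ (suc i) (suc j)

  QuadRepresentable : ∀ {k} → ((Fin k → Bool) → Set) → Set (c ⊔ ℓ)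
  QuadRepresentable {k} S =
    ∃ λ g₀ → ∃₂ λ (g₁ : Fin k → A) (g₂ : Fin k → Fin k → A) → IsQuadRep G S g₀ g₁ g₂

  representable-face : ∀ {k} {S : (Fin (suc k) → Bool) → Set} →
                       QuadRepresentable S → QuadRepresentable (λ x → S (false ∷ x))
  representable-face (g₀ , g₁ , g₂ , rep) = g₀ , tail g₁ , (λ i j → g₂ (suc i) (suc j)) , λ x →
      (λ eval≈ε → proj₁ (rep (false ∷ x)) (≈-trans (quadEval-face g₀ g₁ g₂ x) eval≈ε))
    , (λ s → ≈-trans (≈-sym (quadEval-face g₀ g₁ g₂ x)) (proj₂ (rep (false ∷ x)) s))

  -- Ham (false ∷ x) reduces to Ham x, so restricting LIN6 to a face is LIN6 one dimension lower.
  LIN6-restrict : ∀ {m k} → m ≤′ k → QuadRepresentable (InLIN6 {k}) → QuadRepresentable (InLIN6 {m})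
  LIN6-restrict ≤′-refl         r = r
  LIN6-restrict (≤′-step m≤′k) r = LIN6-restrict m≤′k (representable-face r)

  sum-scale : ∀ {n} h (b : Vector Bool n) → ∑[ t < n ] scale G h (b t) ≈ count b × h
  sum-scale {zero}  h b = ≈-refl
  sum-scale {suc n} h b with b zero
  ... | true  = ∙-congˡ (sum-scale h (tail b))
  ... | false = ≈-trans (identityˡ _) (sum-scale h (tail b))

  momentForm : ∀ {n k} → A → (Fin k → A) → (Fin k → Fin k → A) → Vector (Fin k → Bool) n → A
  momentForm {n} {k} g₀ g₁ g₂ p =
    n × g₀ ∙ (∑[ i < k ] (count (λ t → p t i) × g₁ i)
              ∙ ∑[ i < k ] ∑[ j < k ] (count (λ t → does (i <? j) ∧ (p t i ∧ p t j)) × g₂ i j))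

  sum-quadEval′ : ∀ {n k} g₀ g₁ g₂ (p : Vector (Fin k → Bool) n) →
                  ∑[ t < n ] quadEval′ g₀ g₁ g₂ (p t) ≈ momentForm g₀ g₁ g₂ p
  sum-quadEval′ {n} {k} g₀ g₁ g₂ p = begin
    ∑[ t < n ] (g₀ ∙ (L t ∙ Q t))               ≈⟨ ∑-distrib-+ (λ _ → g₀) (λ t → L t ∙ Q t) ⟩
    ∑[ t < n ] g₀ ∙ ∑[ t < n ] (L t ∙ Q t)      ≈⟨ ∙-cong (sum-replicate n) (∑-distrib-+ L Q) ⟩
    n × g₀ ∙ (∑[ t < n ] L t ∙ ∑[ t < n ] Q t)  ≈⟨ ∙-congˡ (∙-cong linear quadratic) ⟩
    momentForm g₀ g₁ g₂ p                        ∎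
    where
    L Q : Vector A n
    L t = ∑[ i < k ] scale G (g₁ i) (p t i)
    Q t = ∑[ i < k ] ∑[ j < k ] pairTerm g₂ (p t) i j
    linear : ∑[ t < n ] L t ≈ ∑[ i < k ] (count (λ t → p t i) × g₁ i)
    linear = ≈-trans (∑-comm (λ t i → scale G (g₁ i) (p t i)))
                     (sum-cong-≋ {k} λ i → sum-scale (g₁ i) (λ t → p t i))
    quadratic : ∑[ t < n ] Q t
              ≈ ∑[ i < k ] ∑[ j < k ] (count (λ t → does (i <? j) ∧ (p t i ∧ p t j)) × g₂ i j)
    quadratic = ≈-trans (∑-comm (λ t i → ∑[ j < k ] pairTerm g₂ (p t) i j)) (sum-cong-≋ {k} λ i →
                  ≈-trans (∑-comm (λ t j → pairTerm g₂ (p t) i j)) (sum-cong-≋ {k} λ j →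
                    sum-scale (g₂ i j) (λ t → does (i <? j) ∧ (p t i ∧ p t j))))

  momentForm-cong : ∀ {n k} g₀ g₁ g₂ {p q : Vector (Fin k → Bool) n} →
                    SameMoments p q → momentForm g₀ g₁ g₂ p ≈ momentForm g₀ g₁ g₂ q
  momentForm-cong {n} {k} g₀ g₁ g₂ {p} {q} same = ∙-congˡ (∙-cong
      (sum-cong-≋ {k} λ i → ×-congˡ (first i))
      (sum-cong-≋ {k} λ i → sum-cong-≋ {k} λ j → ×-congˡ (upper i j)))
    where
    first : ∀ i → count (λ t → p t i) ≡ count (λ t → q t i)
    first = SameMoments⇒same-first-moments {p = p} {q} same
    upper : ∀ i j → count (λ t → does (i <? j) ∧ (p t i ∧ p t j))
                  ≡ count (λ t → does (i <? j) ∧ (q t i ∧ q t j))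
    upper i j = count-∧ˡ {n} (does (i <? j)) (same i j)

  sum-quadEval-cong : ∀ {n k} g₀ g₁ g₂ {p q : Vector (Fin k → Bool) n} → SameMoments p q →
                      ∑[ t < n ] quadEval G g₀ g₁ g₂ (p t) ≈ ∑[ t < n ] quadEval G g₀ g₁ g₂ (q t)
  sum-quadEval-cong {n} g₀ g₁ g₂ {p} {q} same = begin
    ∑[ t < n ] quadEval G g₀ g₁ g₂ (p t)  ≈⟨ sum-cong-≋ {n} (λ t → quadEval≈quadEval′ g₀ g₁ g₂ (p t)) ⟩
    ∑[ t < n ] quadEval′ g₀ g₁ g₂ (p t)   ≈⟨ sum-quadEval′ g₀ g₁ g₂ p ⟩
    momentForm g₀ g₁ g₂ p                 ≈⟨ momentForm-cong g₀ g₁ g₂ {p} {q} same ⟩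
    momentForm g₀ g₁ g₂ q                 ≈⟨ sum-quadEval′ g₀ g₁ g₂ q ⟨
    ∑[ t < n ] quadEval′ g₀ g₁ g₂ (q t)   ≈⟨ sum-cong-≋ {n} (λ t → quadEval≈quadEval′ g₀ g₁ g₂ (q t)) ⟨
    ∑[ t < n ] quadEval G g₀ g₁ g₂ (q t)  ∎

  representable⇒moment-closed : ∀ {k n} {S : (Fin k → Bool) → Set} → QuadRepresentable S →
    (p : Vector (Fin k → Bool) (suc n)) (x : Fin k → Bool) (q : Vector (Fin k → Bool) n) →
    SameMoments p (x ∷ q) → (∀ t → S (p t)) → (∀ t → S (q t)) → S x
  representable⇒moment-closed {k} {n} (g₀ , g₁ , g₂ , rep) p x q same p∈S q∈S = proj₁ (rep x) (begin
    g x                           ≈⟨ identityʳ (g x) ⟨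
    g x ∙ ε                       ≈⟨ ∙-congˡ (sum-zero (λ t → proj₂ (rep (q t)) (q∈S t))) ⟨
    ∑[ t < suc n ] g ((x ∷ q) t)  ≈⟨ sum-quadEval-cong g₀ g₁ g₂ {p} {x ∷ q} same ⟨
    ∑[ t < suc n ] g (p t)        ≈⟨ sum-zero (λ t → proj₂ (rep (p t)) (p∈S t)) ⟩
    ε                             ∎)
    where
    g : (Fin k → Bool) → A
    g = quadEval G g₀ g₁ g₂

bits : ∀ {k} → Vector ℕ k → Fin k → Bool
bits v i = v i ≡ᵇ 1

lhs : Vector (Fin 8 → Bool) 13
lhs = bits (0 ∷ 1 ∷ 0 ∷ 1 ∷ 1 ∷ 1 ∷ 1 ∷ 1 ∷ [])
    ∷ bits (1 ∷ 0 ∷ 0 ∷ 0 ∷ 0 ∷ 0 ∷ 0 ∷ 0 ∷ [])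
    ∷ bits (1 ∷ 1 ∷ 1 ∷ 1 ∷ 0 ∷ 1 ∷ 1 ∷ 1 ∷ [])
    ∷ bits (1 ∷ 0 ∷ 1 ∷ 1 ∷ 1 ∷ 1 ∷ 1 ∷ 1 ∷ [])
    ∷ bits (1 ∷ 0 ∷ 1 ∷ 1 ∷ 1 ∷ 1 ∷ 1 ∷ 1 ∷ [])
    ∷ bits (1 ∷ 0 ∷ 1 ∷ 1 ∷ 1 ∷ 1 ∷ 1 ∷ 1 ∷ [])
    ∷ bits (0 ∷ 0 ∷ 1 ∷ 0 ∷ 0 ∷ 0 ∷ 0 ∷ 0 ∷ [])
    ∷ bits (1 ∷ 1 ∷ 1 ∷ 1 ∷ 1 ∷ 1 ∷ 1 ∷ 0 ∷ [])
    ∷ bits (1 ∷ 1 ∷ 1 ∷ 1 ∷ 1 ∷ 1 ∷ 0 ∷ 1 ∷ [])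
    ∷ bits (1 ∷ 1 ∷ 0 ∷ 0 ∷ 1 ∷ 1 ∷ 1 ∷ 1 ∷ [])
    ∷ bits (0 ∷ 1 ∷ 1 ∷ 0 ∷ 1 ∷ 1 ∷ 1 ∷ 1 ∷ [])
    ∷ bits (0 ∷ 0 ∷ 0 ∷ 1 ∷ 0 ∷ 0 ∷ 0 ∷ 0 ∷ [])
    ∷ bits (1 ∷ 1 ∷ 1 ∷ 1 ∷ 1 ∷ 0 ∷ 1 ∷ 1 ∷ [])
    ∷ []

fourOnes : Fin 8 → Bool
fourOnes = bits (1 ∷ 1 ∷ 1 ∷ 1 ∷ 0 ∷ 0 ∷ 0 ∷ 0 ∷ [])

rhs : Vector (Fin 8 → Bool) 12
rhs = bits (1 ∷ 0 ∷ 1 ∷ 1 ∷ 1 ∷ 0 ∷ 1 ∷ 1 ∷ [])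
    ∷ bits (1 ∷ 0 ∷ 1 ∷ 1 ∷ 1 ∷ 1 ∷ 0 ∷ 1 ∷ [])
    ∷ bits (1 ∷ 1 ∷ 1 ∷ 0 ∷ 1 ∷ 1 ∷ 1 ∷ 1 ∷ [])
    ∷ bits (1 ∷ 1 ∷ 1 ∷ 0 ∷ 1 ∷ 1 ∷ 1 ∷ 1 ∷ [])
    ∷ bits (1 ∷ 0 ∷ 1 ∷ 1 ∷ 1 ∷ 1 ∷ 1 ∷ 0 ∷ [])
    ∷ bits (0 ∷ 1 ∷ 1 ∷ 1 ∷ 1 ∷ 1 ∷ 1 ∷ 1 ∷ [])
    ∷ bits (0 ∷ 1 ∷ 1 ∷ 1 ∷ 1 ∷ 1 ∷ 1 ∷ 1 ∷ [])
    ∷ bits (1 ∷ 1 ∷ 0 ∷ 1 ∷ 1 ∷ 1 ∷ 1 ∷ 1 ∷ [])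
    ∷ bits (1 ∷ 1 ∷ 0 ∷ 1 ∷ 1 ∷ 1 ∷ 1 ∷ 1 ∷ [])
    ∷ bits (0 ∷ 0 ∷ 0 ∷ 0 ∷ 0 ∷ 0 ∷ 0 ∷ 0 ∷ [])
    ∷ bits (0 ∷ 0 ∷ 0 ∷ 0 ∷ 0 ∷ 0 ∷ 0 ∷ 0 ∷ [])
    ∷ bits (1 ∷ 0 ∷ 1 ∷ 1 ∷ 0 ∷ 1 ∷ 1 ∷ 1 ∷ [])
    ∷ []

lhs⊆LIN6 : ∀ t → InLIN6 (lhs t)
lhs⊆LIN6 = from-yes (all? λ t → inLIN6? (lhs t))

rhs⊆LIN6 : ∀ t → InLIN6 (rhs t)
rhs⊆LIN6 = from-yes (all? λ t → inLIN6? (rhs t))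

fourOnes∉LIN6 : ¬ InLIN6 fourOnes
fourOnes∉LIN6 = from-no (inLIN6? fourOnes)

lhs-moments : SameMoments lhs (fourOnes ∷ rhs)
lhs-moments = from-yes (sameMoments? lhs (fourOnes ∷ rhs))

LIN6-not-representable : ∀ {c ℓ} (G : AbelianGroup c ℓ) {k} → 8 ≤ k → ¬ QuadRepresentable G (InLIN6 {k})
LIN6-not-representable G 8≤k representable = fourOnes∉LIN6
  (representable⇒moment-closed G {S = InLIN6} (LIN6-restrict G (≤⇒≤′ 8≤k) representable)
                               lhs fourOnes rhs lhs-moments lhs⊆LIN6 rhs⊆LIN6)

proposition7p3 : ∀ {c ℓ : Level} (k : ℕ) → 16 ≤ k → (G : AbelianGroup c ℓ) →
    ¬ (∃ λ g₀ → ∃₂ λ (g₁ : Fin k → AbelianGroup.Carrier G) (g₂ : Fin k → Fin k → AbelianGroup.Carrier G) →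
         IsQuadRep G (InLIN6 {k}) g₀ g₁ g₂)
proposition7p3 k 16≤k G = LIN6-not-representable G (≤-trans (m≤m+n 8 8) 16≤k)
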